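{- Every tree-like $\mathrm{Res}(\oplus)$ refutation of $\mathrm{DLO}_n$ has size at least $2^{\lfloor (n-3)/3\rfloor}$, and every $\mathrm{Res}(\oplus)$ refutation of $\mathrm{DLO}_n$ has space at least $\lfloor (n-3)/3\rfloor$.
   Context: $\mathrm{DLO}_n$ is the CNF in the variables $(x_{ij})_{i\ne j\in[n]}$ and $(z_{ikj})$ for distinct $i,k,j\in[n]$, consisting of: $\neg x_{ij}\lor\neg x_{ji}$ for $i\neq j$; $x_{ij}\lor x_{ji}$ for $i\ne j$; $\neg x_{ij}\lor\neg x_{jk}\lor x_{ik}$ for distinct $i,j,k$; $\neg z_{ikj}\lor x_{ik}$ and $\neg z_{ikj}\lor x_{kj}$ for distinct $i,j,k$; and $\neg x_{ij}\lor\bigvee_{k\in[n]\setminus\{i,j\}} z_{ikj}$ for $i\ne j$. It is viewed as a linear CNF by writing $x$ as $(x=1)$, $\neg x$ as $(x=0)$. Linear clauses are disjunctions of equations $f=\alpha$, $f$ a linear form over $\mathbb{F}_2$, $\alpha\in\{0,1\}$. $\mathrm{Res}(\oplus)$ rules: from $A\lor(f=0)$ and $B\lor(f=1)$ derive $A\lor B$; from $C$ derive any linear clause semantically implied by $C$. A refutation derives the empty clause from the formula's clauses; it is tree-like if arrangeable as a binary tree (root: empty clause, leaves: formula clauses, internal nodes: results of rule applications to children), size = number of clauses. Space: a refutation is a sequence of configurations (sets of linear clauses) $S_1=\emptyset,\dots,S_t\ni$ empty clause, each obtained from the previous by adding a formula clause, deleting a clause, or adding a clause deduced from current clauses by the rules;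 its space is $\max_i|S_i|$. -}

module Defs where

open import Data.Nat using (ℕ; suc; _⊔_; _+_)
open import Data.Bool using (Bool; true; false; _xor_)
open import Data.Fin using (Fin; _≟_)
open import Data.List using (List; []; _∷_; [_]; _++_; foldr; concatMap; length; allFin)
open import Data.List.Relation.Unary.Any using (Any)
open import Data.List.Membership.Propositional using (_∈_)
open import Data.Product using (_×_; _,_; ∃-syntax)
open import Relation.Binary.PropositionalEquality using (_≡_; _≢_; sym)
open import Relation.Nullary using (yes; no)

-- Variables of DLO_n : x_{ij} (i ≠ j) and z_{ikj} (i,k,j distinct).
-- Distinctness proofs are irrelevant, so each variable has exactly one
-- representative.

data Var (n : ℕ) : Set where
  x : (i j : Fin n) → .(i ≢ j) → Var n
  z : (i k j : Fin n) → .(i ≢ k) → .(k ≢ j) → .(i ≢ j) → Var n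

Assignment : ℕ → Set
Assignment n = Var n → Bool

LinForm : ℕ → Set
LinForm n = List (Var n)

⟦_⟧ : ∀ {n} → LinForm n → Assignment n → Bool
⟦ f ⟧ ρ = foldr (λ v b → ρ v xor b) false f

-- Two lists denote the same linear form iff they define the same
-- linear function (over F₂ this is equality of coefficient vectors).
_≈ₗ_ : ∀ {n} → LinForm n → LinForm n → Set
f ≈ₗ g = ∀ ρ → ⟦ f ⟧ ρ ≡ ⟦ g ⟧ ρ

Eqn : ℕ → Set
Eqn n = LinForm n × Bool

_≈ₑ_ : ∀ {n} → Eqn n → Eqn n → Set
(f , α) ≈ₑ (g , β) = (f ≈ₗ g) × (α ≡ β)

Clause : ℕ → Set
Clause n = List (Eqn n)

SatE : ∀ {n} → Assignment n → Eqn n → Set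
SatE ρ (f , α) = ⟦ f ⟧ ρ ≡ α

Sat : ∀ {n} → Assignment n → Clause n → Set
Sat ρ C = Any (SatE ρ) C

_∈ₑ_ : ∀ {n} → Eqn n → Clause n → Set
e ∈ₑ C = Any (e ≈ₑ_) C

_⊆ₑ_ : ∀ {n} → Clause n → Clause n → Set
C ⊆ₑ D = ∀ e → e ∈ₑ C → e ∈ₑ D

_≅_ : ∀ {n} → Clause n → Clause n → Set
C ≅ D = (C ⊆ₑ D) × (D ⊆ₑ C)

Resolves : ∀ {n} → Clause n → Clause n → Clause n → Set
Resolves {n} C₁ C₂ D =
  ∃[ f ] ∃[ A ] ∃[ B ]
    (C₁ ≅ ((f , false) ∷ A)) × (C₂ ≅ ((f , true) ∷ B)) × (D ≅ (A ++ B))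

Implies : ∀ {n} → Clause n → Clause n → Set
Implies {n} C D = (ρ : Assignment n) → Sat ρ C → Sat ρ D

Formula : ℕ → Set₁
Formula n = Clause n → Set

data TreeDeriv {n} (F : Formula n) : Clause n → Set where
  axiom : ∀ {C} → F C → TreeDeriv F C
  res   : ∀ {C₁ C₂ D} → TreeDeriv F C₁ → TreeDeriv F C₂ → Resolves C₁ C₂ D → TreeDeriv F D
  weak  : ∀ {C D} → TreeDeriv F C → Implies C D → TreeDeriv F D

size : ∀ {n} {F : Formula n} {C} → TreeDeriv F C → ℕ
size (axiom _)   = 1
size (res p q _) = suc (size p + size q)
size (weak p _)  = suc (size p)

TreeRefutation : ∀ {n} → Formula n → Set
TreeRefutation F = TreeDeriv F []

Config : ℕ → Set
Config n = List (Clause n)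

data Step {n} (F : Formula n) : Config n → Config n → Set where
  download : ∀ {S C} → F C → Step F S (C ∷ S)
  erase    : ∀ A C B → Step F (A ++ C ∷ B) (A ++ B)
  infer-res  : ∀ {S C₁ C₂ D} → C₁ ∈ S → C₂ ∈ S → Resolves C₁ C₂ D → Step F S (D ∷ S)
  infer-weak : ∀ {S C D} → C ∈ S → Implies C D → Step F S (D ∷ S)

data SeqFrom {n} (F : Formula n) : Config n → Set where
  done : ∀ {S} → [] ∈ S → SeqFrom F S
  step : ∀ {S S'} → Step F S S' → SeqFrom F S' → SeqFrom F S

space : ∀ {n} {F : Formula n} {S} → SeqFrom F S → ℕ
space {S = S} (done _)   = length S
space {S = S} (step _ r) = length S ⊔ space r

SpaceRefutation : ∀ {n} → Formula n → Set
SpaceRefutation F = SeqFrom F []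

pos neg : ∀ {n} → Var n → Eqn n
pos v = ([ v ] , true)
neg v = ([ v ] , false)

zlit : ∀ {n} (i j : Fin n) → .(i ≢ j) → Fin n → Clause n
zlit i j p k with i ≟ k | k ≟ j
... | no q | no r = [ pos (z i k j q r p) ]
... | _    | _    = []

zwit : ∀ {n} (i j : Fin n) → .(i ≢ j) → Clause n
zwit {n} i j p = concatMap (zlit i j p) (allFin n)

data DLO (n : ℕ) : Clause n → Set where
  antisym : (i j : Fin n) .(p : i ≢ j) →
            DLO n (neg (x i j p) ∷ neg (x j i (λ e → p (sym e))) ∷ [])
  total   : (i j : Fin n) .(p : i ≢ j) →
            DLO n (pos (x i j p) ∷ pos (x j i (λ e → p (sym e))) ∷ [])
  trans   : (i j k : Fin n) .(p : i ≢ j) .(q : j ≢ k) .(r : i ≢ k) →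
            DLO n (neg (x i j p) ∷ neg (x j k q) ∷ pos (x i k r) ∷ [])
  zleft   : (i k j : Fin n) .(p : i ≢ k) .(q : k ≢ j) .(r : i ≢ j) →
            DLO n (neg (z i k j p q r) ∷ pos (x i k p) ∷ [])
  zright  : (i k j : Fin n) .(p : i ≢ k) .(q : k ≢ j) .(r : i ≢ j) →
            DLO n (neg (z i k j p q r) ∷ pos (x k j q) ∷ [])
  dense   : (i j : Fin n) .(p : i ≢ j) →
            DLO n (neg (x i j p) ∷ zwit i j p)

-- An assignment is order-like if its x-variables are the strict order of an injective
-- ranking of [n] and every true z_{ikj} has k strictly between i and j.  It satisfies
-- every clause of DLO_n except possibly the density clauses ¬x_{ij} ∨ ⋁_k z_{ikj}.
--
-- Key lemma: if an order-like w satisfies a list E of linear equations and 3|E| + 3 ≤ n,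
-- then so does an order-like w′ that also satisfies a prescribed density clause (i, j).
-- Move a nonempty set μ of the n − 2 points other than i, j into the gap between i and j,
-- switch z_{ikj} on for k ∈ μ, and switch off a set U of true z-variables that contains
-- those mentioning a moved point.  If the points below i and above j are inserted in
-- reversed order, the resulting change of w is linear in (μ, U) over F₂, so Gaussian
-- elimination finds μ and U invisible to E, each equation using up at most three points.
--
-- Hence, as long as a configurational refutation holds at most n/3 clauses, each of its
-- configurations is satisfied by an order-like assignment and so lacks the empty clause;
-- this is the space bound.  A tree-like refutation of size below 2^t, evaluated
-- depth-first with the larger premise first, never holds more than t clauses at a time,
-- which gives the size bound.

module Submission where

open import Defs
open import Algebra.Bundles using (CommutativeRing)
open import Data.Bool using (Bool; true; false; not; _∧_; _xor_; if_then_else_)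
open import Data.Bool.Properties
  using (xor-∧-commutativeRing; ∧-distribˡ-xor; ∧-zeroʳ; ∧-identityʳ; ∧-comm;
         xor-identityʳ; xor-same; xor-assoc; xor-comm; ¬-not)
  renaming (_≟_ to _≟ᵇ_)
open import Data.Fin using (Fin; zero; suc; _≟_; toℕ)
import Data.Fin.Properties as Fin
open import Data.Fin.Subset using (Subset; inside; outside; _∈_; _∉_; _-_; ∣_∣; ⊤; Nonempty)
open import Data.Fin.Subset.Properties
  using (_∈?_; nonempty?; Empty-unique; ∣⊥∣≡0; ∣⊤∣≡n; p─q⊆p; p─⊥≡p)
open import Data.List as List using (List; []; _∷_; _++_; length)
open import Data.List.Membership.Propositional using (lose; find) renaming (_∈_ to _∈ₗ_)
open import Data.List.Membership.Propositional.Properties using (∈-allFin)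
open import Data.List.Properties using (length-map)
open import Data.List.Relation.Unary.All as All using (All; []; _∷_)
open import Data.List.Relation.Unary.All.Properties using (map⁻; ++⁺; ++⁻ˡ; ++⁻ʳ)
open import Data.List.Relation.Unary.Any as Any using (Any; here; there; any?; satisfied)
open import Data.List.Relation.Unary.Any.Properties using (concat⁺; map⁺; ++⁺ˡ; ++⁺ʳ)
open import Data.Nat using (ℕ; zero; suc; _+_; _*_; _∸_; _^_; _/_; _<_; _≤_; s≤s; z≤n; _<?_; _≤?_)
open import Data.Nat.DivMod using (m/n*n≤m)
open import Data.Nat.Properties
  using (≤-refl; ≤-reflexive; ≤-trans; <-trans; <-≤-trans; ≤-<-trans; <-irrefl; <-asym; <-cmp;
         <⇒≤; <⇒≢; ≤∧≢⇒<; ≮⇒≥; ≰⇒>; ≤-pred; n≤1+n; n<1+n; suc-injective;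
         +-suc; +-assoc; +-comm; +-identityʳ; m≤m+n; m≤n+m; m<m+n;
         +-monoʳ-≤; +-monoˡ-≤; +-monoʳ-<; +-cancelˡ-≤; +-cancelˡ-<; +-cancelʳ-<; +-cancelˡ-≡;
         *-suc; *-comm; *-distribˡ-+; *-monoʳ-≤; *-cancelˡ-<;
         m∸n≤m; m<n⇒0<n∸m; ∸-monoʳ-<; ∸-cancelʳ-<; ∸-cancelˡ-≡; m≤m⊔n; m≤n⊔m;
         module ≤-Reasoning)
open import Data.Product using (Σ; _×_; _,_; ∃-syntax; proj₁; proj₂)
open import Data.Sum using (_⊎_; inj₁; inj₂; [_,_]′)
open import Data.Vec as Vec using (Vec; []; _∷_; there)
open import Data.Vec.Relation.Unary.All as Allᵛ using ([]; _∷_) renaming (All to Allᵛ)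
import Data.Vec.Relation.Unary.All.Properties as Allᵛₚ
open import Function using (_∘_; case_of_)
open import Function.Bundles using (mk⇔)
open import Relation.Binary.Definitions using (DecidableEquality; tri<; tri≈; tri>)
open import Relation.Binary.PropositionalEquality
  using (_≡_; _≢_; refl; sym; cong; cong₂; subst; subst₂; module ≡-Reasoning)
  renaming (trans to ≡-trans)
open import Relation.Nullary using (yes; no; does; ¬_; contradiction)
open import Relation.Nullary.Decidable using (dec-true; dec-false; _×-dec_; does-⇔)
open import Relation.Nullary.Recomputable using (¬-recompute)

open import Algebra.Properties.Semiring.Sum (CommutativeRing.semiring xor-∧-commutativeRing)
  using (sum-syntax; ∑-distrib-+; *-distribˡ-sum; sum-cong-≗; sum-replicate-zero)
open import Algebra.Properties.CommutativeSemigroup (CommutativeRing.+-commutativeSemigroup xor-∧-commutativeRing)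
  using () renaming (interchange to xor-interchange)

private
  variable
    m : ℕ

-- Linear algebra over F₂

xor-cancelˡ : ∀ a b → a xor (b xor a) ≡ b
xor-cancelˡ a b =
  ≡-trans (cong (a xor_) (xor-comm b a)) (≡-trans (sym (xor-assoc a a b)) (cong (_xor b) (xor-same a)))

xor-same-cancels : ∀ a b → a xor (b xor b) ≡ a
xor-same-cancels a b = ≡-trans (cong (a xor_) (xor-same b)) (xor-identityʳ a)

xor-cancelʳ : ∀ a b → (a xor b) xor b ≡ a
xor-cancelʳ a b = ≡-trans (xor-assoc a b b) (xor-same-cancels a b)

xor-rebase : ∀ s l r → l xor (r xor s) ≡ s xor ((l xor s) xor (r xor s))
xor-rebase false false false = refl
xor-rebase false false true  = refl
xor-rebase false true  false = refl
xor-rebase false true  true  = refl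
xor-rebase true  false false = refl
xor-rebase true  false true  = refl
xor-rebase true  true  false = refl
xor-rebase true  true  true  = refl

module _ {A : Set} where

  infixl 8 _⊕_
  infixr 9 _∙_

  _⊕_ : (A → Bool) → (A → Bool) → A → Bool
  (f ⊕ g) a = f a xor g a

  _∙_ : Bool → (A → Bool) → A → Bool
  (s ∙ f) a = s ∧ f a

module Indicator {A : Set} (_≟_ : DecidableEquality A) where

  unit : A → A → Bool
  unit a b = does (b ≟ a)

  unit-self : ∀ a → unit a a ≡ true
  unit-self a = dec-true (a ≟ a) refl

  ⊕-unit-self : ∀ (ρ : A → Bool) s a → (ρ ⊕ s ∙ unit a) a ≡ ρ a xor s
  ⊕-unit-self ρ s a =
    ≡-trans (cong (λ t → ρ a xor (s ∧ t)) (unit-self a)) (cong (ρ a xor_) (∧-identityʳ s))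

  ⊕-unit-other : ∀ (ρ : A → Bool) s {a b} → b ≢ a → (ρ ⊕ s ∙ unit a) b ≡ ρ b
  ⊕-unit-other ρ s {a} {b} b≢a = begin
    ρ b xor (s ∧ does (b ≟ a)) ≡⟨ cong (λ t → ρ b xor (s ∧ t)) (dec-false (b ≟ a) b≢a) ⟩
    ρ b xor (s ∧ false)        ≡⟨ cong (ρ b xor_) (∧-zeroʳ s) ⟩
    ρ b xor false              ≡⟨ xor-identityʳ (ρ b) ⟩
    ρ b                        ∎
    where open ≡-Reasoning

  ⊕-unit-true : ∀ (ρ : A → Bool) s {a b} → (ρ ⊕ s ∙ unit a) b ≡ true → b ≡ a ⊎ ρ b ≡ true
  ⊕-unit-true ρ s {a} {b} ρ′b = case b ≟ a of λ where
    (yes b≡a) → inj₁ b≡a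
    (no b≢a)  → inj₂ (≡-trans (sym (⊕-unit-other ρ s b≢a)) ρ′b)

  ⊕-unit-⊆ : ∀ (ρ : A → Bool) s {a b} → ρ a ≡ true → (ρ ⊕ s ∙ unit a) b ≡ true → ρ b ≡ true
  ⊕-unit-⊆ ρ s ρa ρ′b = [ (λ { refl → ρa }) , (λ ρb → ρb) ]′ (⊕-unit-true ρ s ρ′b)

infix 7 _·_

_·_ : (Fin m → Bool) → (Fin m → Bool) → Bool
_·_ {m} c μ = ∑[ k < m ] (c k ∧ μ k)

basis : Fin m → Fin m → Bool
basis = Indicator.unit _≟_

·-zeroˡ : ∀ (μ : Fin m → Bool) → (λ _ → false) · μ ≡ false
·-zeroˡ {m} μ = sum-replicate-zero m

·-comm : ∀ (c μ : Fin m → Bool) → c · μ ≡ μ · c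
·-comm c μ = sum-cong-≗ (λ k → ∧-comm (c k) (μ k))

·-⊕ʳ : ∀ (c μ ν : Fin m → Bool) → c · (μ ⊕ ν) ≡ c · μ xor c · ν
·-⊕ʳ c μ ν = ≡-trans (sum-cong-≗ (λ k → ∧-distribˡ-xor (c k) (μ k) (ν k)))
                     (∑-distrib-+ (λ k → c k ∧ μ k) (λ k → c k ∧ ν k))

·-∙ʳ : ∀ (c : Fin m → Bool) s μ → c · (s ∙ μ) ≡ s ∧ c · μ
·-∙ʳ c s μ = ≡-trans (sum-cong-≗ (λ k → ∧-swap (c k) s (μ k)))
                     (sym (*-distribˡ-sum s (λ k → c k ∧ μ k)))
  where
  ∧-swap : ∀ a b d → a ∧ (b ∧ d) ≡ b ∧ (a ∧ d)
  ∧-swap false b d = sym (∧-zeroʳ b)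
  ∧-swap true  b d = refl

·-⊕ˡ : ∀ (c d μ : Fin m → Bool) → (c ⊕ d) · μ ≡ c · μ xor d · μ
·-⊕ˡ c d μ =
  ≡-trans (·-comm (c ⊕ d) μ) (≡-trans (·-⊕ʳ μ c d) (cong₂ _xor_ (·-comm μ c) (·-comm μ d)))

·-∙ˡ : ∀ s (c μ : Fin m → Bool) → (s ∙ c) · μ ≡ s ∧ c · μ
·-∙ˡ s c μ = ≡-trans (·-comm (s ∙ c) μ) (≡-trans (·-∙ʳ μ s c) (cong (s ∧_) (·-comm μ c)))

basis-· : ∀ (a : Fin m) μ → basis a · μ ≡ μ a
basis-· {suc m} zero    μ = ≡-trans (cong (μ zero xor_) (·-zeroˡ (μ ∘ suc))) (xor-identityʳ (μ zero))
basis-· {suc m} (suc a) μ = basis-· a (μ ∘ suc)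

·-basis : ∀ (c : Fin m → Bool) a → c · basis a ≡ c a
·-basis c a = ≡-trans (·-comm c (basis a)) (basis-· a c)

·-vanishes : ∀ (c μ : Fin m → Bool) → (∀ {k} → μ k ≡ true → c k ≡ false) → c · μ ≡ false
·-vanishes c μ c-vanishes = ≡-trans (sum-cong-≗ term) (·-zeroˡ μ)
  where
  term : ∀ k → c k ∧ μ k ≡ false
  term k with μ k in μk
  ... | true  = ≡-trans (∧-identityʳ (c k)) (c-vanishes μk)
  ... | false = ∧-zeroʳ (c k)

x∉p-x : ∀ (p : Subset m) a → a ∉ p - a
x∉p-x (_ ∷ p) zero    ()
x∉p-x (_ ∷ p) (suc a) (there a∈p-a) = x∉p-x p a a∈p-a

x∈p-y⇒x≢y : ∀ (p : Subset m) {a k} → k ∈ p - a → k ≢ a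
x∈p-y⇒x≢y p {a} k∈p-a k≡a = x∉p-x p a (subst (_∈ p - a) k≡a k∈p-a)

∣p∣≤1+∣p-x∣ : ∀ (p : Subset m) a → ∣ p ∣ ≤ suc ∣ p - a ∣
∣p∣≤1+∣p-x∣ (outside ∷ p) zero    = ≤-trans (≤-reflexive (cong ∣_∣ (sym (p─⊥≡p p)))) (n≤1+n _)
∣p∣≤1+∣p-x∣ (inside  ∷ p) zero    = s≤s (≤-reflexive (cong ∣_∣ (sym (p─⊥≡p p))))
∣p∣≤1+∣p-x∣ (outside ∷ p) (suc a) = ∣p∣≤1+∣p-x∣ p a
∣p∣≤1+∣p-x∣ (inside  ∷ p) (suc a) = s≤s (∣p∣≤1+∣p-x∣ p a)

0<∣p∣⇒nonempty : ∀ (p : Subset m) → 0 < ∣ p ∣ → Nonempty p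
0<∣p∣⇒nonempty {m} p 0<∣p∣ with nonempty? p
... | yes nonempty = nonempty
... | no  empty    = contradiction (subst (λ q → 0 < ∣ q ∣) (Empty-unique empty) 0<∣p∣)
                                   (λ 0<∣⊥∣ → <-irrefl (sym (∣⊥∣≡0 m)) 0<∣⊥∣)

removeAll : List (Fin m) → Subset m → Subset m
removeAll []       τ = τ
removeAll (a ∷ as) τ = removeAll as (τ - a)

∣τ∣≤∣removeAll∣ : ∀ (as : List (Fin m)) τ → ∣ τ ∣ ≤ length as + ∣ removeAll as τ ∣
∣τ∣≤∣removeAll∣ []       τ = ≤-refl
∣τ∣≤∣removeAll∣ (a ∷ as) τ =
  ≤-trans (∣p∣≤1+∣p-x∣ τ a) (s≤s (∣τ∣≤∣removeAll∣ as (τ - a)))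

removeAll⊆ : ∀ (as : List (Fin m)) τ {k} → k ∈ removeAll as τ → k ∈ τ
removeAll⊆ []       τ k∈ = k∈
removeAll⊆ (a ∷ as) τ k∈ = p─q⊆p τ _ (removeAll⊆ as (τ - a) k∈)

removeAll-avoids : ∀ (as : List (Fin m)) τ {μ : Fin m → Bool} →
                   (∀ {k} → μ k ≡ true → k ∈ removeAll as τ) → ¬ Any (λ k → μ k ≡ true) as
removeAll-avoids (a ∷ as) τ within (here μa)    = x∉p-x τ a (removeAll⊆ as (τ - a) (within μa))
removeAll-avoids (a ∷ as) τ within (there μas) = removeAll-avoids as (τ - a) within μas

3*suc : ∀ e l → 3 * suc e + l ≡ 3 + (3 * e + l)
3*suc e l = ≡-trans (cong (_+ l) (*-suc 3 e)) (+-assoc 3 (3 * e) l)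

record NonzeroIn (τ : Subset m) (μ : Fin m → Bool) : Set where
  field
    within  : ∀ {k} → μ k ≡ true → k ∈ τ
    nonzero : ∃[ k ] μ k ≡ true

kernel : ∀ {l} (cs : Vec (Fin m → Bool) l) (τ : Subset m) → l < ∣ τ ∣ →
         ∃[ μ ] NonzeroIn τ μ × Allᵛ (λ c → c · μ ≡ false) cs
kernel [] τ 0<∣τ∣ with 0<∣p∣⇒nonempty τ 0<∣τ∣
... | k , k∈τ = basis k , record { within = within ; nonzero = k , Indicator.unit-self _≟_ k } , []
  where
  within : ∀ {k′} → basis k k′ ≡ true → k′ ∈ τ
  within {k′} k′≡k with k′ ≟ k
  ... | yes refl = k∈τ
  ... | no _     = contradiction k′≡k λ ()
kernel {m} (c ∷ cs) τ lt with Fin.any? (λ k → k ∈? τ ×-dec c k ≟ᵇ true)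
... | no c-vanishes-on-τ with kernel cs τ (≤-trans (n≤1+n _) lt)
...   | μ , μ-nonzero , orthogonal = μ , μ-nonzero , ·-vanishes c μ c-vanishes ∷ orthogonal
  where
  c-vanishes : ∀ {k} → μ k ≡ true → c k ≡ false
  c-vanishes {k} μk = ¬-not (λ ck → c-vanishes-on-τ (k , NonzeroIn.within μ-nonzero μk , ck))
kernel {m} (c ∷ cs) τ lt | yes (k₀ , k₀∈τ , ck₀) =
  μ , record { within = within ; nonzero = nonzero } , c-orthogonal ∷ cs-orthogonal
  where
  open ≡-Reasoning
  eliminate : (Fin m → Bool) → Fin m → Bool
  eliminate d = d ⊕ d k₀ ∙ c
  solved = kernel (Vec.map eliminate cs) (τ - k₀) (≤-pred (≤-trans lt (∣p∣≤1+∣p-x∣ τ k₀)))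
  μ′ : Fin m → Bool
  μ′ = proj₁ solved
  open NonzeroIn (proj₁ (proj₂ solved)) renaming (within to within′; nonzero to nonzero′)
  μ : Fin m → Bool
  μ = μ′ ⊕ (c · μ′) ∙ basis k₀
  ·-μ : ∀ d → d · μ ≡ d · μ′ xor d k₀ ∧ c · μ′
  ·-μ d = begin
    d · μ                              ≡⟨ ·-⊕ʳ d μ′ _ ⟩
    d · μ′ xor d · (c · μ′) ∙ basis k₀ ≡⟨ cong (d · μ′ xor_) (·-∙ʳ d (c · μ′) (basis k₀)) ⟩
    d · μ′ xor c · μ′ ∧ d · basis k₀   ≡⟨ cong (λ t → d · μ′ xor c · μ′ ∧ t) (·-basis d k₀) ⟩
    d · μ′ xor c · μ′ ∧ d k₀           ≡⟨ cong (d · μ′ xor_) (∧-comm (c · μ′) (d k₀)) ⟩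
    d · μ′ xor d k₀ ∧ c · μ′           ∎
  eliminate-· : ∀ d → eliminate d · μ′ ≡ d · μ′ xor d k₀ ∧ c · μ′
  eliminate-· d = ≡-trans (·-⊕ˡ d (d k₀ ∙ c) μ′) (cong (d · μ′ xor_) (·-∙ˡ (d k₀) c μ′))
  c-orthogonal : c · μ ≡ false
  c-orthogonal = begin
    c · μ                     ≡⟨ ·-μ c ⟩
    c · μ′ xor c k₀ ∧ c · μ′  ≡⟨ cong (λ t → c · μ′ xor t ∧ c · μ′) ck₀ ⟩
    c · μ′ xor c · μ′         ≡⟨ xor-same (c · μ′) ⟩
    false                     ∎
  cs-orthogonal : Allᵛ (λ d → d · μ ≡ false) cs
  cs-orthogonal = Allᵛ.map (λ {d} d′⊥μ′ → ≡-trans (·-μ d) (≡-trans (sym (eliminate-· d)) d′⊥μ′))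
                           (Allᵛₚ.map⁻ (proj₂ (proj₂ solved)))
  μ-off-k₀ : ∀ {k} → k ≢ k₀ → μ k ≡ μ′ k
  μ-off-k₀ = Indicator.⊕-unit-other _≟_ μ′ (c · μ′)
  within : ∀ {k} → μ k ≡ true → k ∈ τ
  within {k} μk = case k ≟ k₀ of λ where
    (yes refl) → k₀∈τ
    (no k≢k₀)  → p─q⊆p τ _ (within′ (≡-trans (sym (μ-off-k₀ k≢k₀)) μk))
  nonzero : ∃[ k ] μ k ≡ true
  nonzero = let k , μ′k = nonzero′ in
    k , ≡-trans (μ-off-k₀ (x∈p-y⇒x≢y τ (within′ μ′k))) μ′k

-- Linear forms in the variables of DLO_n

module _ {n : ℕ} where

  _≟ᵥ_ : DecidableEquality (Var n)
  x a b _ ≟ᵥ x c d _ with a ≟ c | b ≟ d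
  ... | yes refl | yes refl = yes refl
  ... | no a≢c   | _        = no λ { refl → a≢c refl }
  ... | yes _    | no b≢d   = no λ { refl → b≢d refl }
  x _ _ _ ≟ᵥ z _ _ _ _ _ _ = no λ ()
  z _ _ _ _ _ _ ≟ᵥ x _ _ _ = no λ ()
  z a b c _ _ _ ≟ᵥ z d e f _ _ _ with a ≟ d | b ≟ e | c ≟ f
  ... | yes refl | yes refl | yes refl = yes refl
  ... | no a≢d   | _        | _        = no λ { refl → a≢d refl }
  ... | yes _    | no b≢e   | _        = no λ { refl → b≢e refl }
  ... | yes _    | yes _    | no c≢f   = no λ { refl → c≢f refl }

  open Indicator _≟ᵥ_ public

  Kills : Assignment n → LinForm n → Set
  Kills ρ f = ⟦ f ⟧ ρ ≡ false

  ⟦⟧-cong : ∀ (f : LinForm n) {ρ σ} → (∀ v → ρ v ≡ σ v) → ⟦ f ⟧ ρ ≡ ⟦ f ⟧ σ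
  ⟦⟧-cong []      _   = refl
  ⟦⟧-cong (v ∷ f) ρ≗σ = cong₂ _xor_ (ρ≗σ v) (⟦⟧-cong f ρ≗σ)

  ⟦⟧-⊕ : ∀ (f : LinForm n) ρ σ → ⟦ f ⟧ (ρ ⊕ σ) ≡ ⟦ f ⟧ ρ xor ⟦ f ⟧ σ
  ⟦⟧-⊕ []      ρ σ = refl
  ⟦⟧-⊕ (v ∷ f) ρ σ =
    ≡-trans (cong ((ρ v xor σ v) xor_) (⟦⟧-⊕ f ρ σ)) (xor-interchange (ρ v) (σ v) _ _)

  ⟦⟧-∙ : ∀ (f : LinForm n) s ρ → ⟦ f ⟧ (s ∙ ρ) ≡ s ∧ ⟦ f ⟧ ρ
  ⟦⟧-∙ []      s ρ = sym (∧-zeroʳ s)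
  ⟦⟧-∙ (v ∷ f) s ρ = ≡-trans (cong ((s ∧ ρ v) xor_) (⟦⟧-∙ f s ρ)) (sym (∧-distribˡ-xor s (ρ v) _))

  ⟦⟧-⊕-unit : ∀ (f : LinForm n) ρ s v → ⟦ f ⟧ (ρ ⊕ s ∙ unit v) ≡ ⟦ f ⟧ ρ xor s ∧ ⟦ f ⟧ (unit v)
  ⟦⟧-⊕-unit f ρ s v =
    ≡-trans (⟦⟧-⊕ f ρ (s ∙ unit v)) (cong (⟦ f ⟧ ρ xor_) (⟦⟧-∙ f s (unit v)))

  ⟦⟧-++ : ∀ (f g : LinForm n) ρ → ⟦ f ++ g ⟧ ρ ≡ ⟦ f ⟧ ρ xor ⟦ g ⟧ ρ
  ⟦⟧-++ []      g ρ = refl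
  ⟦⟧-++ (v ∷ f) g ρ = ≡-trans (cong (ρ v xor_) (⟦⟧-++ f g ρ)) (sym (xor-assoc (ρ v) _ _))

  unit-∈ : ∀ (f : LinForm n) {v} → ⟦ f ⟧ (unit v) ≡ true → v ∈ₗ f
  unit-∈ (u ∷ f) {v} fv with u ≟ᵥ v
  ... | yes refl = here refl
  ... | no _     = there (unit-∈ f fv)

  VanishesOnUnits : Assignment n → LinForm n → Set
  VanishesOnUnits A f = ∀ v → A v ≡ true → ⟦ f ⟧ (unit v) ≡ false

  vanishes-on-support : ∀ (f : LinForm n) ρ → VanishesOnUnits ρ f → Kills ρ f
  vanishes-on-support []      ρ _   = refl
  vanishes-on-support (u ∷ f) ρ hyp = begin
    ρ u xor ⟦ f ⟧ ρ                              ≡⟨ cong (ρ u xor_) split ⟩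
    ρ u xor (⟦ f ⟧ ρ₀ xor ρ u ∧ ⟦ f ⟧ (unit u))  ≡⟨ cong (λ t → ρ u xor (t xor ρ u ∧ ⟦ f ⟧ (unit u)))
                                                       (vanishes-on-support f ρ₀ hyp₀) ⟩
    ρ u xor ρ u ∧ ⟦ f ⟧ (unit u)                 ≡⟨ u-term ⟩
    false                                        ∎
    where
    open ≡-Reasoning
    ρ₀ : Assignment n
    ρ₀ = ρ ⊕ ρ u ∙ unit u
    split : ⟦ f ⟧ ρ ≡ ⟦ f ⟧ ρ₀ xor ρ u ∧ ⟦ f ⟧ (unit u)
    split = sym (≡-trans (cong (_xor ρ u ∧ ⟦ f ⟧ (unit u)) (⟦⟧-⊕-unit f ρ (ρ u) u))
                         (xor-cancelʳ (⟦ f ⟧ ρ) _))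
    hyp₀ : VanishesOnUnits ρ₀ f
    hyp₀ v ρ₀v = case v ≟ᵥ u of λ where
      (yes refl) → contradiction (≡-trans (sym ρ₀v) (≡-trans (⊕-unit-self ρ (ρ u) u) (xor-same (ρ u)))) λ ()
      (no v≢u)   → ≡-trans (cong (_xor ⟦ f ⟧ (unit v)) (sym (dec-false (u ≟ᵥ v) (v≢u ∘ sym))))
                           (hyp v (≡-trans (sym (⊕-unit-other ρ (ρ u) v≢u)) ρ₀v))
    u-term : ρ u xor ρ u ∧ ⟦ f ⟧ (unit u) ≡ false
    u-term with ρ u in ρu
    ... | false = refl
    ... | true  = ≡-trans (cong (_xor ⟦ f ⟧ (unit u)) (sym (unit-self u))) (hyp u ρu)

  eliminate : Var n → LinForm n → LinForm n → LinForm n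
  eliminate v f g = if ⟦ g ⟧ (unit v) then g ++ f else g

  ⟦eliminate⟧ : ∀ v f g ρ → ⟦ eliminate v f g ⟧ ρ ≡ ⟦ g ⟧ ρ xor ⟦ g ⟧ (unit v) ∧ ⟦ f ⟧ ρ
  ⟦eliminate⟧ v f g ρ with ⟦ g ⟧ (unit v)
  ... | true  = ⟦⟧-++ g f ρ
  ... | false = sym (xor-identityʳ (⟦ g ⟧ ρ))

  pivot-kills : ∀ (f : LinForm n) ρ {v} → ⟦ f ⟧ (unit v) ≡ true → Kills (ρ ⊕ ⟦ f ⟧ ρ ∙ unit v) f
  pivot-kills f ρ {v} fv = begin
    ⟦ f ⟧ (ρ ⊕ c ∙ unit v)      ≡⟨ ⟦⟧-⊕-unit f ρ c v ⟩
    c xor c ∧ ⟦ f ⟧ (unit v)    ≡⟨ cong (λ t → c xor c ∧ t) fv ⟩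
    c xor c ∧ true              ≡⟨ cong (c xor_) (∧-identityʳ c) ⟩
    c xor c                     ≡⟨ xor-same c ⟩
    false                       ∎
    where
    open ≡-Reasoning
    c = ⟦ f ⟧ ρ

  pivot-lifts : ∀ (f g : LinForm n) ρ v → Kills ρ (eliminate v f g) → Kills (ρ ⊕ ⟦ f ⟧ ρ ∙ unit v) g
  pivot-lifts f g ρ v g′-killed = begin
    ⟦ g ⟧ (ρ ⊕ c ∙ unit v)              ≡⟨ ⟦⟧-⊕-unit g ρ c v ⟩
    ⟦ g ⟧ ρ xor c ∧ ⟦ g ⟧ (unit v)      ≡⟨ cong (⟦ g ⟧ ρ xor_) (∧-comm c (⟦ g ⟧ (unit v))) ⟩
    ⟦ g ⟧ ρ xor ⟦ g ⟧ (unit v) ∧ c      ≡⟨ ⟦eliminate⟧ v f g ρ ⟨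
    ⟦ eliminate v f g ⟧ ρ               ≡⟨ g′-killed ⟩
    false                               ∎
    where
    open ≡-Reasoning
    c = ⟦ f ⟧ ρ

  pivot-invisible : ∀ (p : LinForm n) ρ s {v} → ⟦ p ⟧ (unit v) ≡ false →
                    Kills ρ p → Kills (ρ ⊕ s ∙ unit v) p
  pivot-invisible p ρ s {v} pv p-killed = begin
    ⟦ p ⟧ (ρ ⊕ s ∙ unit v)          ≡⟨ ⟦⟧-⊕-unit p ρ s v ⟩
    ⟦ p ⟧ ρ xor s ∧ ⟦ p ⟧ (unit v)  ≡⟨ cong₂ (λ t u → t xor s ∧ u) p-killed pv ⟩
    false xor s ∧ false             ≡⟨ ∧-zeroʳ s ⟩
    false                           ∎
    where open ≡-Reasoning

  touch : Var n → List (Fin n)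
  touch (x _ _ _)       = []
  touch (z a b c _ _ _) = a ∷ b ∷ c ∷ []

  ∣touch∣≤3 : ∀ v → length (touch v) ≤ 3
  ∣touch∣≤3 (x _ _ _)       = z≤n
  ∣touch∣≤3 (z _ _ _ _ _ _) = ≤-refl

  Touches : (Fin n → Bool) → Var n → Set
  Touches μ v = Any (λ k → μ k ≡ true) (touch v)

  module Elimination (D : Fin n → Assignment n) where

    combination : (Fin n → Bool) → Assignment n
    combination μ v = (λ k → D k v) · μ

    ⟦⟧-combination : ∀ f μ → ⟦ f ⟧ (combination μ) ≡ (λ k → ⟦ f ⟧ (D k)) · μ
    ⟦⟧-combination []      μ = sym (·-zeroˡ μ)
    ⟦⟧-combination (v ∷ f) μ =
      ≡-trans (cong (combination μ v xor_) (⟦⟧-combination f μ)) (sym (·-⊕ˡ (λ k → D k v) _ μ))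

    record Solution {e l} (E : Vec (LinForm n) e) (P : Vec (LinForm n) l)
                    (A : Assignment n) (τ : Subset n) : Set where
      field
        μ         : Fin n → Bool
        U         : Assignment n
        μ-nonzero : NonzeroIn τ μ
        U⊆A       : ∀ {v} → U v ≡ true → A v ≡ true
        U-covers  : ∀ {v} → A v ≡ true → Touches μ v → U v ≡ true
        kills-E   : Allᵛ (Kills (combination μ ⊕ U)) E
        kills-P   : Allᵛ (Kills (combination μ ⊕ U)) P

    solve-pending : ∀ {l} (P : Vec (LinForm n) l) A τ →
                    Allᵛ (VanishesOnUnits A) P → l < ∣ τ ∣ → Solution [] P A τ
    solve-pending P A τ P-vanishes l<∣τ∣ with kernel (Vec.map (λ p k → ⟦ p ⟧ (D k)) P) τ l<∣τ∣
    ... | μ , μ-nonzero , orthogonal = record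
      { μ = μ ; U = A ; μ-nonzero = μ-nonzero ; U⊆A = λ Av → Av ; U-covers = λ Av _ → Av
      ; kills-E = [] ; kills-P = Allᵛ.map (λ {p} → kills p) (Allᵛ.zip (Allᵛₚ.map⁻ orthogonal , P-vanishes))
      }
      where
      kills : ∀ p → (λ k → ⟦ p ⟧ (D k)) · μ ≡ false × VanishesOnUnits A p → Kills (combination μ ⊕ A) p
      kills p (p⊥μ , p-vanishes) = begin
        ⟦ p ⟧ (combination μ ⊕ A)           ≡⟨ ⟦⟧-⊕ p (combination μ) A ⟩
        ⟦ p ⟧ (combination μ) xor ⟦ p ⟧ A   ≡⟨ cong₂ _xor_ (≡-trans (⟦⟧-combination p μ) p⊥μ)
                                                       (vanishes-on-support p A p-vanishes) ⟩
        false                               ∎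
        where open ≡-Reasoning

    postpone : ∀ {e l} {f} {E : Vec (LinForm n) e} {P : Vec (LinForm n) l} {A τ} →
               Solution E (f ∷ P) A τ → Solution (f ∷ E) P A τ
    postpone R = record
      { μ = μ ; U = U ; μ-nonzero = μ-nonzero ; U⊆A = U⊆A ; U-covers = U-covers
      ; kills-E = Allᵛ.head kills-P ∷ kills-E ; kills-P = Allᵛ.tail kills-P }
      where open Solution R

    lift-pivot : ∀ {e l} {f} {E : Vec (LinForm n) e} {P : Vec (LinForm n) l} {A τ} v →
                 A v ≡ true → ⟦ f ⟧ (unit v) ≡ true → Allᵛ (VanishesOnUnits A) P →
                 Solution (Vec.map (eliminate v f) E) P (A ⊕ true ∙ unit v) (removeAll (touch v) τ) →
                 Solution (f ∷ E) P A τ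
    lift-pivot {f = f} {E} {P} {A} {τ} v Av fv P-vanishes R = record
      { μ = R.μ ; U = U ; μ-nonzero = μ-nonzero ; U⊆A = U⊆A ; U-covers = U-covers
      ; kills-E = regroup f (pivot-kills f shift′ fv)
                ∷ Allᵛ.map (λ {g} → regroup g ∘ pivot-lifts f g shift′ v) (Allᵛₚ.map⁻ R.kills-E)
      ; kills-P = Allᵛ.map (λ {p} (p-vanishes , p-killed) →
                              regroup p (pivot-invisible p shift′ c (p-vanishes v Av) p-killed))
                           (Allᵛ.zip (P-vanishes , R.kills-P))
      }
      where
      module R = Solution R
      shift′ : Assignment n
      shift′ = combination R.μ ⊕ R.U
      c : Bool
      c = ⟦ f ⟧ shift′
      U : Assignment n
      U = R.U ⊕ c ∙ unit v
      regroup : ∀ g → Kills (shift′ ⊕ c ∙ unit v) g → Kills (combination R.μ ⊕ U) g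
      regroup g = ≡-trans (⟦⟧-cong g (λ u → sym (xor-assoc (combination R.μ u) (R.U u) _)))
      μ-nonzero : NonzeroIn τ R.μ
      μ-nonzero = record
        { within  = λ μk → removeAll⊆ (touch v) τ (NonzeroIn.within R.μ-nonzero μk)
        ; nonzero = NonzeroIn.nonzero R.μ-nonzero
        }
      U⊆A : ∀ {u} → U u ≡ true → A u ≡ true
      U⊆A Uu = [ (λ { refl → Av }) , ⊕-unit-⊆ A true Av ∘ R.U⊆A ]′ (⊕-unit-true R.U c Uu)
      U-covers : ∀ {u} → A u ≡ true → Touches R.μ u → U u ≡ true
      U-covers {u} Au μ-touches-u = case u ≟ᵥ v of λ where
        (yes refl) → contradiction μ-touches-u (removeAll-avoids (touch v) τ (NonzeroIn.within R.μ-nonzero))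
        (no u≢v)   → ≡-trans (⊕-unit-other R.U c u≢v)
                             (R.U-covers (≡-trans (⊕-unit-other A true u≢v) Au) μ-touches-u)

    -- Each equation either has a pivot among the switchable variables A, which is
    -- eliminated at the cost of the (at most three) points touching it, or is
    -- postponed to P, to be satisfied by the choice of μ alone at the cost of one point.
    solve : ∀ {e l} (E : Vec (LinForm n) e) (P : Vec (LinForm n) l) (A : Assignment n) (τ : Subset n) →
            Allᵛ (VanishesOnUnits A) P → 3 * e + l < ∣ τ ∣ → Solution E P A τ
    solve [] P A τ P-vanishes room = solve-pending P A τ P-vanishes room
    solve {suc e} {l} (f ∷ E) P A τ P-vanishes room
      with any? (λ v → A v ≟ᵇ true ×-dec ⟦ f ⟧ (unit v) ≟ᵇ true) f
    ... | no no-pivot =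
      postpone (solve E (f ∷ P) A τ (f-vanishes ∷ P-vanishes) (≤-trans (s≤s postpone-cost) room))
      where
      f-vanishes : VanishesOnUnits A f
      f-vanishes v Av = ¬-not λ fv → no-pivot (lose (unit-∈ f fv) (Av , fv))
      postpone-cost : 3 * e + suc l ≤ 3 * suc e + l
      postpone-cost = ≤-trans (≤-reflexive (+-suc (3 * e) l))
                              (≤-trans (m≤n+m _ 2) (≤-reflexive (sym (3*suc e l))))
    ... | yes pivot with satisfied pivot
    ...   | v , Av , fv = lift-pivot v Av fv P-vanishes
                            (solve (Vec.map (eliminate v f) E) P (A ⊕ true ∙ unit v) τ′
                                   (Allᵛ.map (λ p-vanishes u → p-vanishes u ∘ ⊕-unit-⊆ A true Av) P-vanishes)
                                   pivot-cost)
      where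
      τ′ = removeAll (touch v) τ
      pivot-cost : 3 * e + l < ∣ τ′ ∣
      pivot-cost = +-cancelˡ-≤ 3 _ _ (begin
        3 + suc (3 * e + l)           ≡⟨ cong suc (3*suc e l) ⟨
        suc (3 * suc e + l)           ≤⟨ room ⟩
        ∣ τ ∣                         ≤⟨ ∣τ∣≤∣removeAll∣ (touch v) τ ⟩
        length (touch v) + ∣ τ′ ∣     ≤⟨ +-monoˡ-≤ ∣ τ′ ∣ (∣touch∣≤3 v) ⟩
        3 + ∣ τ′ ∣                    ∎)
        where open ≤-Reasoning

-- Order-like assignments

module _ {n : ℕ} where

  pos-sat : ∀ (ρ : Assignment n) {v} → ρ v ≡ true → SatE ρ (pos v)
  pos-sat ρ {v} ρv = ≡-trans (xor-identityʳ (ρ v)) ρv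

  neg-sat : ∀ (ρ : Assignment n) {v} → ρ v ≡ false → SatE ρ (neg v)
  neg-sat ρ {v} ρv = ≡-trans (xor-identityʳ (ρ v)) ρv

  zwit-sat : ∀ (ρ : Assignment n) i j .(p : i ≢ j) k (i≢k : i ≢ k) (k≢j : k ≢ j) →
             ρ (z i k j i≢k k≢j p) ≡ true → Sat ρ (zwit i j p)
  zwit-sat ρ i j p k i≢k k≢j ρz = concat⁺ (map⁺ (lose (∈-allFin k) zlit-sat))
    where
    zlit-sat : Sat ρ (zlit i j p k)
    zlit-sat with i ≟ k | k ≟ j
    ... | yes i≡k | _       = contradiction i≡k i≢k
    ... | no _    | yes k≡j = contradiction k≡j k≢j
    ... | no _    | no _    = here (pos-sat ρ ρz)

  Density : Clause n → Set
  Density C = ∃[ i ] ∃[ j ] Σ (i ≢ j) λ p → C ≡ neg (x i j p) ∷ zwit i j p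

  record OrderLike (w : Assignment n) : Set where
    field
      rank           : Fin n → ℕ
      bound          : ℕ
      rank<bound     : ∀ a → rank a < bound
      rank-injective : ∀ {a b} → rank a ≡ rank b → a ≡ b
      x-by-rank      : ∀ a b .(p : a ≢ b) → w (x a b p) ≡ does (rank a <? rank b)
      z-between      : ∀ a b c .(p : a ≢ b) .(q : b ≢ c) .(r : a ≢ c) →
                       w (z a b c p q r) ≡ true → rank a < rank b × rank b < rank c

    x-true : ∀ {a b} .(p : a ≢ b) → rank a < rank b → w (x a b p) ≡ true
    x-true {a} {b} p a<b = ≡-trans (x-by-rank a b p) (dec-true (rank a <? rank b) a<b)

    x-false : ∀ {a b} .(p : a ≢ b) → ¬ rank a < rank b → w (x a b p) ≡ false
    x-false {a} {b} p a≮b = ≡-trans (x-by-rank a b p) (dec-false (rank a <? rank b) a≮b)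

    satisfies-non-density : ∀ {C} → DLO n C → Density C ⊎ Sat w C
    satisfies-non-density (antisym i j p) with rank i <? rank j
    ... | yes i<j = inj₂ (there (here (neg-sat w (x-false _ (<-asym i<j)))))
    ... | no  i≮j = inj₂ (here (neg-sat w (x-false p i≮j)))
    satisfies-non-density (total i j p) with <-cmp (rank i) (rank j)
    ... | tri< i<j _ _ = inj₂ (here (pos-sat w (x-true p i<j)))
    ... | tri≈ _ i≡j _ = contradiction (rank-injective i≡j) (¬-recompute p)
    ... | tri> _ _ j<i = inj₂ (there (here (pos-sat w (x-true _ j<i))))
    satisfies-non-density (trans i j k p q r) with rank i <? rank j | rank j <? rank k
    ... | no  i≮j | _        = inj₂ (here (neg-sat w (x-false p i≮j)))
    ... | yes _   | no  j≮k  = inj₂ (there (here (neg-sat w (x-false q j≮k))))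
    ... | yes i<j | yes j<k  = inj₂ (there (there (here (pos-sat w (x-true r (<-trans i<j j<k))))))
    satisfies-non-density (zleft i k j p q r) with w (z i k j p q r) in wz
    ... | false = inj₂ (here (neg-sat w wz))
    ... | true  = inj₂ (there (here (pos-sat w (x-true p (proj₁ (z-between i k j p q r wz))))))
    satisfies-non-density (zright i k j p q r) with w (z i k j p q r) in wz
    ... | false = inj₂ (here (neg-sat w wz))
    ... | true  = inj₂ (there (here (pos-sat w (x-true q (proj₂ (z-between i k j p q r wz))))))
    satisfies-non-density (dense i j p) = inj₁ (i , j , ¬-recompute p , refl)

-- Repairing a density clause

does-+-< : ∀ m {p q} → does (m + p <? m + q) ≡ does (p <? q)
does-+-< m {p} {q} = does-⇔ (mk⇔ (+-cancelˡ-< m p q) (+-monoʳ-< m)) (m + p <? m + q) (p <? q)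

module MixedRadix (S : ℕ) where

  ⟪_,_⟫ : ℕ → ℕ → ℕ
  ⟪ b , s ⟫ = S * b + s

  ⟪⟫-<-block : ∀ {b₁ s₁ b₂ s₂} → s₁ < S → b₁ < b₂ → ⟪ b₁ , s₁ ⟫ < ⟪ b₂ , s₂ ⟫
  ⟪⟫-<-block {b₁} {s₁} {b₂} {s₂} s₁<S b₁<b₂ = begin-strict
    S * b₁ + s₁  <⟨ +-monoʳ-< (S * b₁) s₁<S ⟩
    S * b₁ + S   ≡⟨ +-comm (S * b₁) S ⟩
    S + S * b₁   ≡⟨ *-suc S b₁ ⟨
    S * suc b₁   ≤⟨ *-monoʳ-≤ S b₁<b₂ ⟩
    S * b₂       ≤⟨ m≤m+n (S * b₂) s₂ ⟩
    S * b₂ + s₂  ∎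
    where open ≤-Reasoning

  ⟪⟫-<-digit : ∀ b {s₁ s₂} → does (⟪ b , s₁ ⟫ <? ⟪ b , s₂ ⟫) ≡ does (s₁ <? s₂)
  ⟪⟫-<-digit b = does-+-< (S * b)

  ⟪⟫-<-same-digit : ∀ {b₁ b₂} s → s < S → does (⟪ b₁ , s ⟫ <? ⟪ b₂ , s ⟫) ≡ does (b₁ <? b₂)
  ⟪⟫-<-same-digit {b₁} {b₂} s s<S =
    does-⇔ (mk⇔ reflect (⟪⟫-<-block s<S)) (⟪ b₁ , s ⟫ <? ⟪ b₂ , s ⟫) (b₁ <? b₂)
    where
    reflect : ⟪ b₁ , s ⟫ < ⟪ b₂ , s ⟫ → b₁ < b₂
    reflect lt with <-cmp b₁ b₂
    ... | tri< b₁<b₂ _ _ = b₁<b₂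
    ... | tri≈ _ refl _ = contradiction lt (<-irrefl refl)
    ... | tri> _ _ b₂<b₁ = contradiction lt (<-asym (⟪⟫-<-block s<S b₂<b₁))

  ⟪⟫-injective : ∀ b₁ b₂ {s₁ s₂} → s₁ < S → s₂ < S →
                 ⟪ b₁ , s₁ ⟫ ≡ ⟪ b₂ , s₂ ⟫ → b₁ ≡ b₂ × s₁ ≡ s₂
  ⟪⟫-injective b₁ b₂ {s₁} {s₂} s₁<S s₂<S eq with <-cmp b₁ b₂
  ... | tri< b₁<b₂ _ _ = contradiction eq (<⇒≢ (⟪⟫-<-block s₁<S b₁<b₂))
  ... | tri≈ _ refl _ = refl , +-cancelˡ-≡ (S * b₁) s₁ s₂ eq
  ... | tri> _ _ b₂<b₁ = contradiction (sym eq) (<⇒≢ (⟪⟫-<-block s₂<S b₂<b₁))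

  ⟪⟫<S*B : ∀ {b s B} → s < S → b < B → ⟪ b , s ⟫ < S * B
  ⟪⟫<S*B {b} {s} {B} s<S b<B = <-≤-trans (⟪⟫-<-block s<S b<B) (≤-reflexive (+-identityʳ (S * B)))

<-flip : ∀ {p q} → p ≢ q → does (q <? p) ≡ not (does (p <? q))
<-flip {p} {q} p≢q with <-cmp p q
... | tri< p<q _ _ rewrite dec-false (q <? p) (<-asym p<q) | dec-true (p <? q) p<q = refl
... | tri≈ _ p≡q _ = contradiction p≡q p≢q
... | tri> _ _ q<p rewrite dec-true (q <? p) q<p | dec-false (p <? q) (<-asym q<p) = refl

∸-reverses-< : ∀ {B p q} → p ≤ B → does (B ∸ p <? B ∸ q) ≡ does (q <? p)
∸-reverses-< {B} {p} {q} p≤B =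
  does-⇔ (mk⇔ (∸-cancelʳ-< {p} {q} {B}) (λ q<p → ∸-monoʳ-< q<p p≤B)) (B ∸ p <? B ∸ q) (q <? p)

module DensityRepair {n : ℕ} {w : Assignment n} (W : OrderLike w) (i j : Fin n)
                     (i<j : OrderLike.rank W i < OrderLike.rank W j) where

  open OrderLike W

  private
    B S : ℕ
    B = bound
    S = suc (B + B)

  open MixedRadix S

  B<S : B < S
  B<S = s≤s (m≤m+n B B)

  -- New ranks are two-digit numbers ⟪ block , digit ⟫ in base S = 2B + 1; a point that
  -- stays keeps its rank as block and gets the middle digit B.
  stay : Fin n → ℕ
  stay a = ⟪ rank a , B ⟫

  stay-< : ∀ a b → does (stay a <? stay b) ≡ does (rank a <? rank b)
  stay-< a b = ⟪⟫-<-same-digit {rank a} {rank b} B B<S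

  data Side (a : Fin n) : Set where
    before  : rank a < rank i → Side a
    after   : rank j < rank a → Side a
    between : ¬ rank a < rank i → ¬ rank j < rank a → Side a

  side : ∀ a → Side a
  side a with rank a <? rank i | rank j <? rank a
  ... | yes a<i | _       = before a<i
  ... | no  a≮i | yes j<a = after j<a
  ... | no  a≮i | no  a≯j = between a≮i a≯j

  -- Points before i go just after i and points after j just before j, both in
  -- reversed order: reversal is what makes the effect of moving several points additive.
  movedTo : ∀ a → Side a → ℕ
  movedTo a (before _)    = ⟪ rank i , B + (B ∸ rank a) ⟫
  movedTo a (after _)     = ⟪ rank j , B ∸ suc (rank a) ⟫
  movedTo a (between _ _) = stay a

  moved : Fin n → ℕ
  moved a = movedTo a (side a)

  digit-before<S : ∀ a → B + (B ∸ rank a) < S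
  digit-before<S a = s≤s (+-monoʳ-≤ B (m∸n≤m B (rank a)))

  digit-after<B : ∀ a → B ∸ suc (rank a) < B
  digit-after<B a = ∸-monoʳ-< (s≤s z≤n) (rank<bound a)

  digit-after<S : ∀ a → B ∸ suc (rank a) < S
  digit-after<S a = <-trans (digit-after<B a) B<S

  moved-additive : ∀ {a b} (sa : Side a) (sb : Side b) → rank a ≢ rank b →
                   does (movedTo a sa <? movedTo b sb)
                   ≡ does (movedTo a sa <? stay b) xor does (stay a <? movedTo b sb) xor does (stay a <? stay b)
  moved-additive {a} {b} (between _ _) sb _ = sym (xor-cancelˡ (does (stay a <? stay b)) _)
  moved-additive {a} {b} sa@(before _) (between _ _) _ =
    sym (xor-same-cancels (does (movedTo a sa <? stay b)) (does (stay a <? stay b)))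
  moved-additive {a} {b} sa@(after _)  (between _ _) _ =
    sym (xor-same-cancels (does (movedTo a sa <? stay b)) (does (stay a <? stay b)))
  moved-additive {a} {b} (before a<i) (before b<i) a≢b
    rewrite ⟪⟫-<-digit (rank i) {B + (B ∸ rank a)} {B + (B ∸ rank b)}
          | does-+-< B {B ∸ rank a} {B ∸ rank b}
          | ∸-reverses-< {B} {rank a} {rank b} (<⇒≤ (rank<bound a))
          | dec-false (⟪ rank i , B + (B ∸ rank a) ⟫ <? stay b) (<-asym (⟪⟫-<-block B<S b<i))
          | dec-true (stay a <? ⟪ rank i , B + (B ∸ rank b) ⟫) (⟪⟫-<-block B<S a<i)
          | stay-< a b
          = <-flip a≢b
  moved-additive {a} {b} (after j<a) (after j<b) a≢b
    rewrite ⟪⟫-<-digit (rank j) {B ∸ suc (rank a)} {B ∸ suc (rank b)}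
          | ∸-reverses-< {B} {suc (rank a)} {suc (rank b)} (rank<bound a)
          | dec-true (⟪ rank j , B ∸ suc (rank a) ⟫ <? stay b) (⟪⟫-<-block (digit-after<S a) j<b)
          | dec-false (stay a <? ⟪ rank j , B ∸ suc (rank b) ⟫) (<-asym (⟪⟫-<-block (digit-after<S b) j<a))
          | stay-< a b
          = <-flip a≢b
  moved-additive {a} {b} (before a<i) (after j<b) _
    rewrite dec-true (⟪ rank i , B + (B ∸ rank a) ⟫ <? ⟪ rank j , B ∸ suc (rank b) ⟫)
                     (⟪⟫-<-block (digit-before<S a) i<j)
          | dec-true (⟪ rank i , B + (B ∸ rank a) ⟫ <? stay b) (⟪⟫-<-block (digit-before<S a) (<-trans i<j j<b))
          | dec-true (stay a <? ⟪ rank j , B ∸ suc (rank b) ⟫) (⟪⟫-<-block B<S (<-trans a<i i<j))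
          | dec-true (stay a <? stay b) (⟪⟫-<-block B<S (<-trans a<i (<-trans i<j j<b)))
          = refl
  moved-additive {a} {b} (after j<a) (before b<i) _
    rewrite dec-false (⟪ rank j , B ∸ suc (rank a) ⟫ <? ⟪ rank i , B + (B ∸ rank b) ⟫)
                      (<-asym (⟪⟫-<-block (digit-before<S b) i<j))
          | dec-false (⟪ rank j , B ∸ suc (rank a) ⟫ <? stay b) (<-asym (⟪⟫-<-block B<S (<-trans b<i i<j)))
          | dec-false (stay a <? ⟪ rank i , B + (B ∸ rank b) ⟫)
                      (<-asym (⟪⟫-<-block (digit-before<S b) (<-trans i<j j<a)))
          | dec-false (stay a <? stay b) (<-asym (⟪⟫-<-block B<S (<-trans b<i (<-trans i<j j<a))))
          = refl

  position : (Fin n → Bool) → Fin n → ℕ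
  position μ a = if μ a then moved a else stay a

  flip-by-moving-left flip-by-moving-right : Fin n → Fin n → Bool
  flip-by-moving-left  a b = does (moved a <? stay b) xor does (stay a <? stay b)
  flip-by-moving-right a b = does (stay a <? moved b) xor does (stay a <? stay b)

  position-additive : ∀ μ {a b} → rank a ≢ rank b →
                      does (position μ a <? position μ b)
                      ≡ does (stay a <? stay b) xor (μ a ∧ flip-by-moving-left a b xor μ b ∧ flip-by-moving-right a b)
  position-additive μ {a} {b} a≢b with μ a | μ b
  ... | false | false = sym (xor-identityʳ _)
  ... | true  | false = sym (≡-trans (cong (does (stay a <? stay b) xor_) (xor-identityʳ _))
                                     (xor-cancelˡ (does (stay a <? stay b)) (does (moved a <? stay b))))
  ... | false | true  = sym (xor-cancelˡ (does (stay a <? stay b)) _)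
  ... | true  | true  = ≡-trans (moved-additive (side a) (side b) a≢b)
                                (xor-rebase (does (stay a <? stay b)) (does (moved a <? stay b)) (does (stay a <? moved b)))

  B<digit-before : ∀ a → B < B + (B ∸ rank a)
  B<digit-before a = m<m+n B (m<n⇒0<n∸m (rank<bound a))

  data Slot (a : Fin n) : ℕ → Set where
    stays    : Slot a (stay a)
    after-i  : Slot a ⟪ rank i , B + (B ∸ rank a) ⟫
    before-j : Slot a ⟪ rank j , B ∸ suc (rank a) ⟫

  movedTo-slot : ∀ a (sa : Side a) → Slot a (movedTo a sa)
  movedTo-slot a (before _)    = after-i
  movedTo-slot a (after _)     = before-j
  movedTo-slot a (between _ _) = stays

  position-slot : ∀ μ a → Slot a (position μ a)
  position-slot μ a with μ a
  ... | true  = movedTo-slot a (side a)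
  ... | false = stays

  slot-bounded : ∀ {a p} → Slot a p → p < S * B
  slot-bounded {a} stays    = ⟪⟫<S*B B<S (rank<bound a)
  slot-bounded {a} after-i  = ⟪⟫<S*B (digit-before<S a) (rank<bound i)
  slot-bounded {a} before-j = ⟪⟫<S*B (digit-after<S a) (rank<bound j)

  slot-injective : ∀ {a b p q} → Slot a p → Slot b q → p ≡ q → a ≡ b
  slot-injective {a} {b} stays stays eq =
    rank-injective (proj₁ (⟪⟫-injective (rank a) (rank b) B<S B<S eq))
  slot-injective {a} {b} stays after-i eq =
    contradiction (proj₂ (⟪⟫-injective (rank a) (rank i) B<S (digit-before<S b) eq)) (<⇒≢ (B<digit-before b))
  slot-injective {a} {b} stays before-j eq =
    contradiction (proj₂ (⟪⟫-injective (rank a) (rank j) B<S (digit-after<S b) eq)) (<⇒≢ (digit-after<B b) ∘ sym)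
  slot-injective {a} {b} after-i stays eq =
    contradiction (proj₂ (⟪⟫-injective (rank i) (rank b) (digit-before<S a) B<S eq)) (<⇒≢ (B<digit-before a) ∘ sym)
  slot-injective {a} {b} after-i after-i eq =
    rank-injective (∸-cancelˡ-≡ (<⇒≤ (rank<bound a)) (<⇒≤ (rank<bound b))
                     (+-cancelˡ-≡ B _ _
                       (proj₂ (⟪⟫-injective (rank i) (rank i) (digit-before<S a) (digit-before<S b) eq))))
  slot-injective {a} {b} after-i before-j eq =
    contradiction (proj₂ (⟪⟫-injective (rank i) (rank j) (digit-before<S a) (digit-after<S b) eq))
                  (<⇒≢ (<-trans (digit-after<B b) (B<digit-before a)) ∘ sym)
  slot-injective {a} {b} before-j stays eq =
    contradiction (proj₂ (⟪⟫-injective (rank j) (rank b) (digit-after<S a) B<S eq)) (<⇒≢ (digit-after<B a))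
  slot-injective {a} {b} before-j after-i eq =
    contradiction (proj₂ (⟪⟫-injective (rank j) (rank i) (digit-after<S a) (digit-before<S b) eq))
                  (<⇒≢ (<-trans (digit-after<B a) (B<digit-before b)))
  slot-injective {a} {b} before-j before-j eq =
    rank-injective (suc-injective (∸-cancelˡ-≡ (rank<bound a) (rank<bound b)
                     (proj₂ (⟪⟫-injective (rank j) (rank j) (digit-after<S a) (digit-after<S b) eq))))

  gap-contains-movedTo : ∀ b (sb : Side b) → b ≢ i → b ≢ j → stay i < movedTo b sb × movedTo b sb < stay j
  gap-contains-movedTo b (before _) _ _ =
    +-monoʳ-< (S * rank i) (B<digit-before b) , ⟪⟫-<-block (digit-before<S b) i<j
  gap-contains-movedTo b (after _) _ _ =
    ⟪⟫-<-block B<S i<j , +-monoʳ-< (S * rank j) (digit-after<B b)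
  gap-contains-movedTo b (between b≮i b≯j) b≢i b≢j =
    ⟪⟫-<-block B<S (≤∧≢⇒< (≮⇒≥ b≮i) (b≢i ∘ rank-injective ∘ sym)) ,
    ⟪⟫-<-block B<S (≤∧≢⇒< (≮⇒≥ b≯j) (b≢j ∘ rank-injective))

  -- The effect on w of moving k alone into the gap and switching z_{ikj} on.
  D : Fin n → Assignment n
  D k (x a b _)       = (flip-by-moving-left a b ∙ basis a ⊕ flip-by-moving-right a b ∙ basis b) k
  D k (z a b c _ _ _) = ((does (a ≟ i) ∧ does (c ≟ j)) ∙ basis b) k

  open Elimination D

  combination-x : ∀ μ a b .(p : a ≢ b) →
                  combination μ (x a b p) ≡ μ a ∧ flip-by-moving-left a b xor μ b ∧ flip-by-moving-right a b
  combination-x μ a b p = begin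
    (Δˡ ∙ basis a ⊕ Δʳ ∙ basis b) · μ
      ≡⟨ ·-⊕ˡ (Δˡ ∙ basis a) (Δʳ ∙ basis b) μ ⟩
    (Δˡ ∙ basis a) · μ xor (Δʳ ∙ basis b) · μ
      ≡⟨ cong₂ _xor_ (·-∙ˡ Δˡ (basis a) μ) (·-∙ˡ Δʳ (basis b) μ) ⟩
    Δˡ ∧ basis a · μ xor Δʳ ∧ basis b · μ
      ≡⟨ cong₂ (λ s t → Δˡ ∧ s xor Δʳ ∧ t) (basis-· a μ) (basis-· b μ) ⟩
    Δˡ ∧ μ a xor Δʳ ∧ μ b
      ≡⟨ cong₂ _xor_ (∧-comm Δˡ (μ a)) (∧-comm Δʳ (μ b)) ⟩
    μ a ∧ Δˡ xor μ b ∧ Δʳ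
      ∎
    where
    open ≡-Reasoning
    Δˡ = flip-by-moving-left a b
    Δʳ = flip-by-moving-right a b

  combination-z : ∀ μ a b c .(p : a ≢ b) .(q : b ≢ c) .(r : a ≢ c) →
                  combination μ (z a b c p q r) ≡ (does (a ≟ i) ∧ does (c ≟ j)) ∧ μ b
  combination-z μ a b c p q r =
    ≡-trans (·-∙ˡ (does (a ≟ i) ∧ does (c ≟ j)) (basis b) μ)
            (cong ((does (a ≟ i) ∧ does (c ≟ j)) ∧_) (basis-· b μ))

  switchable : Assignment n
  switchable (x _ _ _)       = false
  switchable (z a b c p q r) = w (z a b c p q r)

  candidates : Subset n
  candidates = ⊤ - i - j

  candidate-≢ : ∀ {k} → k ∈ candidates → k ≢ i × k ≢ j
  candidate-≢ k∈ = x∈p-y⇒x≢y ⊤ (p─q⊆p (⊤ - i) _ k∈) , x∈p-y⇒x≢y (⊤ - i) k∈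

  n≤2+∣candidates∣ : n ≤ 2 + ∣ candidates ∣
  n≤2+∣candidates∣ = subst (_≤ 2 + ∣ candidates ∣) (∣⊤∣≡n n)
                       (≤-trans (∣p∣≤1+∣p-x∣ ⊤ i) (s≤s (∣p∣≤1+∣p-x∣ (⊤ - i) j)))

  module Repaired {e} {E : Vec (LinForm n) e} (sol : Solution E [] switchable candidates) where

    open Solution sol

    w′ : Assignment n
    w′ = w ⊕ (combination μ ⊕ U)

    μ-avoids : ∀ {k} → μ k ≡ true → k ≢ i × k ≢ j
    μ-avoids μk = candidate-≢ (NonzeroIn.within μ-nonzero μk)

    unmoved : ∀ {a} → μ a ≡ false → position μ a ≡ stay a
    unmoved {a} μa = cong (λ t → if t then moved a else stay a) μa

    U⇒w : ∀ {v} → U v ≡ true → w v ≡ true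
    U⇒w {x _ _ _}       Uv = contradiction (U⊆A Uv) λ ()
    U⇒w {z _ _ _ _ _ _} Uv = U⊆A Uv

    x-by-position : ∀ a b .(p : a ≢ b) → w′ (x a b p) ≡ does (position μ a <? position μ b)
    x-by-position a b p = begin
      w (x a b p) xor (combination μ (x a b p) xor U (x a b p))
        ≡⟨ cong₂ (λ s t → s xor (t xor U (x a b p)))
                 (≡-trans (x-by-rank a b p) (sym (stay-< a b))) (combination-x μ a b p) ⟩
      does (stay a <? stay b) xor ((μ a ∧ Δˡ xor μ b ∧ Δʳ) xor U (x a b p))
        ≡⟨ cong (λ t → does (stay a <? stay b) xor ((μ a ∧ Δˡ xor μ b ∧ Δʳ) xor t)) U-off ⟩
      does (stay a <? stay b) xor ((μ a ∧ Δˡ xor μ b ∧ Δʳ) xor false)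
        ≡⟨ cong (does (stay a <? stay b) xor_) (xor-identityʳ _) ⟩
      does (stay a <? stay b) xor (μ a ∧ Δˡ xor μ b ∧ Δʳ)
        ≡⟨ position-additive μ (¬-recompute p ∘ rank-injective) ⟨
      does (position μ a <? position μ b)
        ∎
      where
      open ≡-Reasoning
      Δˡ = flip-by-moving-left a b
      Δʳ = flip-by-moving-right a b
      U-off : U (x a b p) ≡ false
      U-off = ¬-not (λ Ux → contradiction (U⊆A Ux) λ ())

    old-between : ∀ a b c .(p : a ≢ b) .(q : b ≢ c) .(r : a ≢ c) →
                  w (z a b c p q r) xor U (z a b c p q r) ≡ true →
                  position μ a < position μ b × position μ b < position μ c
    old-between a b c p q r h with w (z a b c p q r) in wz | U (z a b c p q r) in Uz
    ... | true  | true  = contradiction h λ ()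
    ... | false | false = contradiction h λ ()
    ... | false | true  = contradiction (≡-trans (sym wz) (U⇒w Uz)) λ ()
    ... | true  | false =
      subst₂ _<_ (sym (unmoved μa)) (sym (unmoved μb)) (⟪⟫-<-block B<S a<b) ,
      subst₂ _<_ (sym (unmoved μb)) (sym (unmoved μc)) (⟪⟫-<-block B<S b<c)
      where
      untouched : ¬ Touches μ (z a b c p q r)
      untouched μ-touches = contradiction (≡-trans (sym Uz) (U-covers wz μ-touches)) λ ()
      μa : μ a ≡ false
      μa = ¬-not (λ μa → untouched (here μa))
      μb : μ b ≡ false
      μb = ¬-not (λ μb → untouched (there (here μb)))
      μc : μ c ≡ false
      μc = ¬-not (λ μc → untouched (there (there (here μc))))
      a<b = proj₁ (z-between a b c p q r wz)
      b<c = proj₂ (z-between a b c p q r wz)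

    new-between : ∀ {b} → μ b ≡ true → position μ i < position μ b × position μ b < position μ j
    new-between {b} μb = subst₂ _<_ (sym (unmoved μi)) (sym b-moved) (proj₁ gap) ,
                         subst₂ _<_ (sym b-moved) (sym (unmoved μj)) (proj₂ gap)
      where
      gap = gap-contains-movedTo b (side b) (proj₁ (μ-avoids μb)) (proj₂ (μ-avoids μb))
      b-moved = cong (λ t → if t then moved b else stay b) μb
      μi = ¬-not (λ μi → proj₁ (μ-avoids μi) refl)
      μj = ¬-not (λ μj → proj₂ (μ-avoids μj) refl)

    z-between′ : ∀ a b c .(p : a ≢ b) .(q : b ≢ c) .(r : a ≢ c) →
                 w (z a b c p q r) xor ((does (a ≟ i) ∧ does (c ≟ j)) ∧ μ b xor U (z a b c p q r)) ≡ true →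
                 position μ a < position μ b × position μ b < position μ c
    z-between′ a b c p q r h with a ≟ i | c ≟ j
    ... | yes refl | yes refl = by-μb (μ b) refl h
      where
      by-μb : ∀ t → μ b ≡ t → w (z i b j p q r) xor (t xor U (z i b j p q r)) ≡ true →
              position μ i < position μ b × position μ b < position μ j
      by-μb true  μb _ = new-between μb
      by-μb false _  h = old-between i b j p q r h
    ... | yes _ | no _ = old-between a b c p q r h
    ... | no _  | _    = old-between a b c p q r h

    order-like : OrderLike w′
    order-like = record
      { rank           = position μ
      ; bound          = S * B
      ; rank<bound     = λ a → slot-bounded (position-slot μ a)
      ; rank-injective = λ {a} {b} → slot-injective (position-slot μ a) (position-slot μ b)
      ; x-by-rank      = x-by-position
      ; z-between      = λ a b c p q r w′z →
          z-between′ a b c p q r (≡-trans (cong (λ t → w (z a b c p q r) xor (t xor U (z a b c p q r)))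
                                                (sym (combination-z μ a b c p q r))) w′z)
      }

    density-repaired : .(p : i ≢ j) → Sat w′ (neg (x i j p) ∷ zwit i j p)
    density-repaired p = there (zwit-sat w′ i j p k i≢k k≢j (begin
      w zᵢₖⱼ xor (combination μ zᵢₖⱼ xor U zᵢₖⱼ)
        ≡⟨ cong (λ t → w zᵢₖⱼ xor (t xor U zᵢₖⱼ)) (combination-z μ i k j i≢k k≢j p) ⟩
      w zᵢₖⱼ xor ((does (i ≟ i) ∧ does (j ≟ j)) ∧ μ k xor U zᵢₖⱼ)
        ≡⟨ cong₂ (λ s t → w zᵢₖⱼ xor (s xor t)) switched-on U-matches-w ⟩
      w zᵢₖⱼ xor (true xor w zᵢₖⱼ)
        ≡⟨ xor-cancelˡ (w zᵢₖⱼ) true ⟩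
      true
        ∎))
      where
      open ≡-Reasoning
      k = proj₁ (NonzeroIn.nonzero μ-nonzero)
      μk = proj₂ (NonzeroIn.nonzero μ-nonzero)
      i≢k : i ≢ k
      i≢k = proj₁ (μ-avoids μk) ∘ sym
      k≢j : k ≢ j
      k≢j = proj₂ (μ-avoids μk)
      zᵢₖⱼ = z i k j i≢k k≢j p
      switched-on : (does (i ≟ i) ∧ does (j ≟ j)) ∧ μ k ≡ true
      switched-on rewrite dec-true (i ≟ i) refl | dec-true (j ≟ j) refl = μk
      U-matches-w : U zᵢₖⱼ ≡ w zᵢₖⱼ
      U-matches-w with w zᵢₖⱼ in wz
      ... | true  = U-covers wz (there (here μk))
      ... | false = ¬-not (λ Uz → contradiction (≡-trans (sym wz) (U⇒w Uz)) λ ())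

    preserves : ∀ {f α} → SatE w (f , α) → Kills (combination μ ⊕ U) f → SatE w′ (f , α)
    preserves {f} {α} wf shift-kills-f = begin
      ⟦ f ⟧ (w ⊕ (combination μ ⊕ U))              ≡⟨ ⟦⟧-⊕ f w _ ⟩
      ⟦ f ⟧ w xor ⟦ f ⟧ (combination μ ⊕ U)        ≡⟨ cong₂ _xor_ wf shift-kills-f ⟩
      α xor false                                  ≡⟨ xor-identityʳ α ⟩
      α                                            ∎
      where open ≡-Reasoning

  repair : ∀ (E : List (Eqn n)) → All (SatE w) E → 3 * length E + 3 ≤ n → .(p : i ≢ j) →
           ∃[ w′ ] OrderLike w′ × All (SatE w′) E × Sat w′ (neg (x i j p) ∷ zwit i j p)
  repair E E-sat E-small p =
    R.w′ , R.order-like ,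
    All.zipWith (λ {(f , α)} (wf , kills) → R.preserves {f} {α} wf kills) (E-sat , E-killed) ,
    R.density-repaired p
    where
    forms : Vec (LinForm n) (length (List.map proj₁ E))
    forms = Vec.fromList (List.map proj₁ E)
    enough : 3 * length (List.map proj₁ E) + 0 < ∣ candidates ∣
    enough = begin-strict
      3 * length (List.map proj₁ E) + 0  ≡⟨ cong (λ l → 3 * l + 0) (length-map proj₁ E) ⟩
      3 * length E + 0                   ≡⟨ +-identityʳ (3 * length E) ⟩
      3 * length E                       <⟨ +-cancelˡ-≤ 2 _ _ (≤-trans (≤-reflexive (+-comm 3 (3 * length E)))
                                                                   (≤-trans E-small n≤2+∣candidates∣)) ⟩
      ∣ candidates ∣                     ∎
      where open ≤-Reasoning
    sol = solve forms [] switchable candidates [] enough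
    module R = Repaired sol
    E-killed : All (λ (f , _) → Kills (combination (Solution.μ sol) ⊕ Solution.U sol) f) E
    E-killed = map⁻ (Allᵛₚ.fromList⁻ (Solution.kills-E sol))

-- Refutations

module _ {n : ℕ} where

  satisfy-axiom : ∀ {w} → OrderLike w → ∀ {E : List (Eqn n)} → All (SatE w) E → 3 * length E + 3 ≤ n →
                  ∀ {C} → DLO n C → ∃[ w′ ] OrderLike w′ × All (SatE w′) E × Sat w′ C
  satisfy-axiom {w} W E-sat E-small ax with OrderLike.satisfies-non-density W ax
  ... | inj₂ C-sat = w , W , E-sat , C-sat
  ... | inj₁ (i , j , p , refl) with OrderLike.rank W i <? OrderLike.rank W j
  ...   | yes i<j = DensityRepair.repair W i j i<j _ E-sat E-small p
  ...   | no  i≮j = w , W , E-sat , here (neg-sat w (OrderLike.x-false W p i≮j))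

  ≈ₑ-refl : ∀ (e : Eqn n) → e ≈ₑ e
  ≈ₑ-refl _ = (λ _ → refl) , refl

  sat-⊆ₑ : ∀ ρ {C D : Clause n} → C ⊆ₑ D → Sat ρ C → Sat ρ D
  sat-⊆ₑ ρ {e ∷ _} C⊆D (here ρe) =
    Any.map (λ { {g , _} (f≈g , refl) → ≡-trans (sym (f≈g ρ)) ρe }) (C⊆D e (here (≈ₑ-refl e)))
  sat-⊆ₑ ρ {_ ∷ _} C⊆D (there ρC) = sat-⊆ₑ ρ (λ e e∈C → C⊆D e (there e∈C)) ρC

  resolution-sound : ∀ ρ {C₁ C₂ D : Clause n} → Resolves C₁ C₂ D → Sat ρ C₁ → Sat ρ C₂ → Sat ρ D
  resolution-sound ρ (f , A , B , (C₁⊆ , _) , (C₂⊆ , _) , (_ , ⊆D)) s₁ s₂ =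
    sat-⊆ₑ ρ ⊆D (cut (sat-⊆ₑ ρ C₁⊆ s₁) (sat-⊆ₑ ρ C₂⊆ s₂))
    where
    cut : Sat ρ ((f , false) ∷ A) → Sat ρ ((f , true) ∷ B) → Sat ρ (A ++ B)
    cut (here f≡0) (here f≡1) = contradiction (≡-trans (sym f≡0) f≡1) λ ()
    cut (there sA) _          = ++⁺ˡ sA
    cut (here _)   (there sB) = ++⁺ʳ A sB

  OrderSatisfiable : Config n → Set
  OrderSatisfiable S = ∃[ w ] OrderLike w × All (Sat w) S

  initial : OrderSatisfiable []
  initial = w₀ , W₀ , []
    where
    w₀ : Assignment n
    w₀ (x a b _)       = does (toℕ a <? toℕ b)
    w₀ (z _ _ _ _ _ _) = false
    W₀ : OrderLike w₀
    W₀ = record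
      { rank = toℕ ; bound = n ; rank<bound = Fin.toℕ<n ; rank-injective = Fin.toℕ-injective
      ; x-by-rank = λ _ _ _ → refl ; z-between = λ _ _ _ _ _ _ () }

  no-empty-clause : ∀ {S} → OrderSatisfiable S → ¬ ([] ∈ₗ S)
  no-empty-clause (_ , _ , S-sat) []∈S with All.lookup S-sat []∈S
  ... | ()

  witnessing-equations : ∀ w {S : Config n} → All (Sat w) S →
    ∃[ E ] length E ≡ length S × All (SatE w) E × (∀ w′ → All (SatE w′) E → All (Sat w′) S)
  witnessing-equations w [] = [] , refl , [] , λ _ _ → []
  witnessing-equations w (C-sat ∷ S-sat) with find C-sat | witnessing-equations w S-sat
  ... | e , e∈C , e-sat | E , E-length , E-sat , E⇒S =
    e ∷ E , cong suc E-length , e-sat ∷ E-sat ,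
    λ { w′ (e-sat′ ∷ E-sat′) → lose e∈C e-sat′ ∷ E⇒S w′ E-sat′ }

  add-axiom : ∀ {S C} → OrderSatisfiable S → 3 * length S + 3 ≤ n → DLO n C → OrderSatisfiable (C ∷ S)
  add-axiom {S} (w , W , S-sat) S-small ax with witnessing-equations w S-sat
  ... | E , E-length , E-sat , E⇒S
    with satisfy-axiom W E-sat (subst (λ l → 3 * l + 3 ≤ n) (sym E-length) S-small) ax
  ...   | w′ , W′ , E-sat′ , C-sat = w′ , W′ , C-sat ∷ E⇒S w′ E-sat′

  tree-invariant : ∀ {C S} (π : TreeDeriv (DLO n) C) t → size π < 2 ^ t →
                   OrderSatisfiable S → 3 * (length S + t) ≤ n → OrderSatisfiable (C ∷ S)
  tree-invariant (axiom _) zero (s≤s ()) _ _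
  tree-invariant (res _ _ _) zero (s≤s ()) _ _
  tree-invariant {S = S} (axiom ax) (suc t) _ good room = add-axiom good leaf-room ax
    where
    leaf-room : 3 * length S + 3 ≤ n
    leaf-room = begin
      3 * length S + 3      ≡⟨ *-distribˡ-+ 3 (length S) 1 ⟨
      3 * (length S + 1)    ≤⟨ *-monoʳ-≤ 3 (+-monoʳ-≤ (length S) (s≤s z≤n)) ⟩
      3 * (length S + suc t) ≤⟨ room ⟩
      n                     ∎
      where open ≤-Reasoning
  tree-invariant (weak π imp) t bound good room with tree-invariant π t (<-trans (n<1+n _) bound) good room
  ... | w , W , C-sat ∷ S-sat = w , W , imp w C-sat ∷ S-sat
  tree-invariant {S = S} (res π₁ π₂ r) (suc t) bound good room with size π₂ <? 2 ^ t
  ... | yes π₂-small with tree-invariant π₁ (suc t) (<-trans (s≤s (m≤m+n _ _)) bound) good room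
  ...   | good₁ with tree-invariant π₂ t π₂-small good₁ (subst (λ l → 3 * l ≤ n) (+-suc (length S) t) room)
  ...     | w , W , C₂-sat ∷ C₁-sat ∷ S-sat = w , W , resolution-sound w r C₁-sat C₂-sat ∷ S-sat
  tree-invariant {S = S} (res π₁ π₂ r) (suc t) bound good room | no π₂-large
    with tree-invariant π₂ (suc t) (<-trans (s≤s (m≤n+m _ _)) bound) good room
  ...   | good₂ with tree-invariant π₁ t π₁-small good₂ (subst (λ l → 3 * l ≤ n) (+-suc (length S) t) room)
    where
    π₁-small : size π₁ < 2 ^ t
    π₁-small = +-cancelʳ-< (2 ^ t) (size π₁) (2 ^ t) (begin-strict
      size π₁ + 2 ^ t        ≤⟨ +-monoʳ-≤ (size π₁) (≮⇒≥ π₂-large) ⟩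
      size π₁ + size π₂      <⟨ <-trans (n<1+n _) bound ⟩
      2 ^ suc t              ≡⟨ cong (2 ^ t +_) (+-identityʳ (2 ^ t)) ⟩
      2 ^ t + 2 ^ t          ∎)
      where open ≤-Reasoning
  ...     | w , W , C₁-sat ∷ C₂-sat ∷ S-sat = w , W , resolution-sound w r C₁-sat C₂-sat ∷ S-sat

  tree-size-bound : (π : TreeRefutation (DLO n)) → ∀ t → 3 * t ≤ n → 2 ^ t ≤ size π
  tree-size-bound π t room with 2 ^ t ≤? size π
  ... | yes large = large
  ... | no  small = contradiction (here refl) (no-empty-clause (tree-invariant π t (≰⇒> small) initial room))

  length≤space : ∀ {S} (r : SeqFrom (DLO n) S) → length S ≤ space r
  length≤space (done _)   = ≤-refl
  length≤space (step _ r) = m≤m⊔n _ (space r)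

  step-preserves : ∀ {S S′} → Step (DLO n) S S′ → OrderSatisfiable S →
                   OrderSatisfiable S′ ⊎ n < 3 * length S′
  step-preserves {S} (download ax) good with 3 * length S + 3 ≤? n
  ... | yes room = inj₁ (add-axiom good room ax)
  ... | no  full =
    inj₂ (<-≤-trans (≰⇒> full) (≤-reflexive (≡-trans (+-comm (3 * length S) 3) (sym (*-suc 3 (length S))))))
  step-preserves (erase A _ _) (w , W , S-sat) = inj₁ (w , W , ++⁺ (++⁻ˡ A S-sat) (All.tail (++⁻ʳ A S-sat)))
  step-preserves (infer-res C₁∈S C₂∈S r) (w , W , S-sat) =
    inj₁ (w , W , resolution-sound w r (All.lookup S-sat C₁∈S) (All.lookup S-sat C₂∈S) ∷ S-sat)
  step-preserves (infer-weak C∈S imp) (w , W , S-sat) = inj₁ (w , W , imp w (All.lookup S-sat C∈S) ∷ S-sat)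

  space-invariant : ∀ {S} (r : SeqFrom (DLO n) S) → OrderSatisfiable S → n < 3 * space r
  space-invariant (done []∈S) good = contradiction []∈S (no-empty-clause good)
  space-invariant {S} (step s r) good with step-preserves s good
  ... | inj₁ good′ = <-≤-trans (space-invariant r good′) (*-monoʳ-≤ 3 (m≤n⊔m (length S) (space r)))
  ... | inj₂ full  = <-≤-trans full (*-monoʳ-≤ 3 (≤-trans (length≤space r) (m≤n⊔m (length S) (space r))))

  space-bound : (π : SpaceRefutation (DLO n)) → ∀ t → 3 * t ≤ n → t ≤ space π
  space-bound π t room = <⇒≤ (*-cancelˡ-< 3 t (space π) (≤-<-trans room (space-invariant π initial)))

theorem3p9 : (n : ℕ) →
    ((π : TreeRefutation (DLO n)) → 2 ^ ((n ∸ 3) / 3) ≤ size π)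
    × ((π : SpaceRefutation (DLO n)) → (n ∸ 3) / 3 ≤ space π)
theorem3p9 n = (λ π → tree-size-bound π t room) , (λ π → space-bound π t room)
  where
  t = (n ∸ 3) / 3
  room : 3 * t ≤ n
  room = begin
    3 * t              ≡⟨ *-comm 3 t ⟩
    t * 3              ≤⟨ m/n*n≤m (n ∸ 3) 3 ⟩
    n ∸ 3              ≤⟨ m∸n≤m n 3 ⟩
    n                  ∎
    where open ≤-Reasoning
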